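{- Let $F$ be a $4$-Ore graph. Then every nonempty proper subset $A\subsetneq V(F)$ satisfies $\rho_{F,\mathbf 3}(A)\ge \rho_{\mathbf 3}(F)+6$.
   Context: For a simple graph $F$ and $A\subseteq V(F)$, $\rho_{F,\mathbf 3}(A)=8|A|-5|E(F[A])|$, and $\rho_{\mathbf 3}(F)=\rho_{F,\mathbf 3}(V(F))$. A split of a vertex $u$ into $u_1,u_2$: partition $N(u)$ into nonempty $U_1,U_2$, delete $u$, add new $u_1,u_2$ with $N(u_i)=U_i$. A DHGO-composition of $G_1,G_2$: delete an edge $xy$ of $G_1$, split a vertex $z$ of $G_2$ into $z_1,z_2$, identify $x$ with $z_1$ and $y$ with $z_2$. A graph is $4$-Ore if it is $K_4$ or a DHGO-composition of two $4$-Ore graphs. -}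

module Defs where

open import Data.Nat as ℕ using (ℕ; suc; _*_; _<ᵇ_; _≡ᵇ_)
open import Data.Bool using (Bool; true; false; _∧_; not)
open import Data.Fin using (Fin; toℕ; punchIn; zero; suc)
open import Data.Fin.Subset using (Subset; ∣_∣; ⊤)
open import Data.Vec using (lookup)
open import Data.List using (List; allFin; concatMap; map; filterᵇ; length)
open import Data.Product using (Σ; ∃; ∃-syntax; _×_; _,_)
open import Data.Sum using (_⊎_; inj₁; inj₂)
open import Data.Integer as ℤ using (ℤ; +_; _-_)
open import Relation.Binary.PropositionalEquality using (_≡_; _≢_; refl)
open import Relation.Nullary using (¬_)
open import Function.Bundles using (_↔_; Inverse; _⇔_)

record Graph : Set where
  field
    n      : ℕ
    adj    : Fin n → Fin n → Bool
    sym    : ∀ u v → adj u v ≡ adj v u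
    irrefl : ∀ u → adj u u ≡ false
open Graph public

pairs : (k : ℕ) → List (Fin k × Fin k)
pairs k = concatMap (λ i → map (λ j → (i , j)) (filterᵇ (λ j → toℕ i <ᵇ toℕ j) (allFin k))) (allFin k)

eInd : (F : Graph) → Subset (n F) → ℕ
eInd F A = length (filterᵇ (λ { (i , j) → lookup A i ∧ lookup A j ∧ adj F i j }) (pairs (n F)))

ρ3 : (F : Graph) → Subset (n F) → ℤ
ρ3 F A = + (8 * ∣ A ∣) - + (5 * eInd F A)

ρ3G : Graph → ℤ
ρ3G F = ρ3 F ⊤

_≅_ : Graph → Graph → Set
G ≅ H = Σ (Fin (n G) ↔ Fin (n H)) λ φ →
          ∀ u v → adj H (Inverse.to φ u) (Inverse.to φ v) ≡ adj G u v

K4 : Graph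
K4 = record { n = 4 ; adj = adj4 ; sym = sym4 ; irrefl = irr4 }
  where
    adj4 : Fin 4 → Fin 4 → Bool
    adj4 i j = not (toℕ i ≡ᵇ toℕ j)
    sym4 : ∀ u v → adj4 u v ≡ adj4 v u
    sym4 zero zero = refl
    sym4 zero (suc v) = refl
    sym4 (suc u) zero = refl
    sym4 (suc zero) (suc zero) = refl
    sym4 (suc zero) (suc (suc v)) = refl
    sym4 (suc (suc u)) (suc zero) = refl
    sym4 (suc (suc zero)) (suc (suc zero)) = refl
    sym4 (suc (suc zero)) (suc (suc (suc zero))) = refl
    sym4 (suc (suc (suc zero))) (suc (suc zero)) = refl
    sym4 (suc (suc (suc zero))) (suc (suc (suc zero))) = refl
    irr4 : ∀ u → adj4 u u ≡ false
    irr4 zero = refl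
    irr4 (suc zero) = refl
    irr4 (suc (suc zero)) = refl
    irr4 (suc (suc (suc zero))) = refl

-- Adjacency of the DHGO-composition of G1 and G2, on the vertex set
-- V(G1) ⊎ (V(G2) - z), where G2 has vertex set Fin (suc m), the vertex z is
-- split into z1 = x and z2 = y, the vertices of V(G2) - z are punchIn z j
-- (j : Fin m), and side j = true means punchIn z j is put in U1 (else U2).
compAdj : (G1 : Graph) (m : ℕ) (G2 : Graph) → n G2 ≡ suc m →
          (x y : Fin (n G1)) (z : Fin (suc m)) (side : Fin m → Bool) →
          Fin (n G1) ⊎ Fin m → Fin (n G1) ⊎ Fin m → Set
compAdj G1 m G2 refl x y z side = go
  where
    nb : Fin m → Bool
    nb j = adj G2 z (punchIn z j)
    cross : Fin (n G1) → Fin m → Set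
    cross a j = (a ≡ x × nb j ≡ true × side j ≡ true)
              ⊎ (a ≡ y × nb j ≡ true × side j ≡ false)
    go : Fin (n G1) ⊎ Fin m → Fin (n G1) ⊎ Fin m → Set
    go (inj₁ a) (inj₁ b) = adj G1 a b ≡ true × ¬ ((a ≡ x × b ≡ y) ⊎ (a ≡ y × b ≡ x))
    go (inj₂ j) (inj₂ k) = adj G2 (punchIn z j) (punchIn z k) ≡ true
    go (inj₁ a) (inj₂ j) = cross a j
    go (inj₂ j) (inj₁ a) = cross a j

-- H is (isomorphic to) a DHGO-composition of G1 and G2: delete an edge xy of G1,
-- split a vertex z of G2 into z1, z2 (N(z) partitioned into nonempty U1, U2),
-- identify x with z1 and y with z2.
DHGO : Graph → Graph → Graph → Set
DHGO G1 G2 H =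
  Σ ℕ λ m → Σ (n G2 ≡ suc m) λ e →
  Σ (Fin (n G1)) λ x → Σ (Fin (n G1)) λ y → Σ (Fin (suc m)) λ z →
  Σ (Fin m → Bool) λ side →
    adj G1 x y ≡ true
  × (∃[ j ] (adjZ e z j ≡ true × side j ≡ true))
  × (∃[ j ] (adjZ e z j ≡ true × side j ≡ false))
  × Σ (Fin (n H) ↔ (Fin (n G1) ⊎ Fin m)) λ φ →
      ∀ u v → (adj H u v ≡ true) ⇔ compAdj G1 m G2 e x y z side (Inverse.to φ u) (Inverse.to φ v)
  where
    adjZ : ∀ {m} → n G2 ≡ suc m → Fin (suc m) → Fin m → Bool
    adjZ refl z j = adj G2 z (punchIn z j)

-- 4-Ore graphs (closed under isomorphism, as the paper's graphs are up to isomorphism).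
data FourOre : Graph → Set where
  k4   : ∀ {F} → K4 ≅ F → FourOre F
  comp : ∀ {G1 G2 H} → FourOre G1 → FourOre G2 → DHGO G1 G2 H → FourOre H

-- Write p(S) = 2ρ(S) = 16|S| − 10 e(S).  By induction over the 4-Ore structure we prove the
-- stronger invariant p(V) ≤ 4 and p(S) ≥ p(V) + 12 for every nonempty proper S.  For K₄ it is
-- a finite check.  Let H be a DHGO-composition of G₁ and G₂ (edge xy deleted, z split).  A
-- subset S of V(H) gives S₁ = S ∩ V(G₁) and S₂ = (S ∩ V(G₂ − z)) ∪ {z if x ∈ S or y ∈ S}, and
--   p_H(S) = p₁(S₁) + p₂(S₂) − loss,   loss = 16[z ∈ S₂] − 10[x, y ∈ S] − 10·missing,
-- where missing counts the edges zj of G₂[S₂] whose image in H (xj or yj) leaves S; in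
-- particular p_H(V) = p₁(V) + p₂(V) − 6.  By induction p_i(S_i) is at least p_i(V) + 12,
-- p_i(V) or p_i(V) − 4 as S_i is proper, full or empty.  Moreover loss ≤ 16, loss ≤ 0 if
-- z ∉ S₂, and loss ≤ 6 if x, y ∈ S or S₂ = V(G₂): in the latter case an endpoint of xy outside
-- S receives a nonempty part of N(z), all of it missing.  Each of the nine cases then gives
-- p_H(S) ≥ p_H(V) + 12.

module Submission where

open import Defs using (Graph; n; adj; irrefl; K4; DHGO; compAdj; FourOre; k4; comp; eInd; ρ3; ρ3G)

module FourOrePotential where

  open import Algebra.Bundles using (CommutativeMonoid)
  open import Data.Bool.Base using (Bool; true; false; _∧_; _∨_; not; if_then_else_)
  open import Data.Bool.Properties
    using (∧-assoc; ∧-comm; ∧-zeroʳ; ∧-identityʳ; ∨-zeroʳ; ∧-commutativeMonoid; ¬-not)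
    renaming (_≟_ to _≟ᵇ_)
  open import Algebra.Properties.CommutativeSemigroup (CommutativeMonoid.commutativeSemigroup ∧-commutativeMonoid)
    using (x∙yz≈y∙xz)
  open import Data.Fin.Base using (Fin; zero; suc; toℕ; _↑ˡ_; _↑ʳ_; splitAt; join)
  open import Data.Fin.Properties using (_≟_; any?; toℕ-injective; splitAt⁻¹-↑ˡ; splitAt⁻¹-↑ʳ; splitAt-join; +↔⊎)
  open import Data.Fin.Patterns using (0F; 1F; 2F; 3F)
  import Data.Fin.Permutation as Perm
  open import Data.Fin.Subset using (Subset; ∣_∣)
  open import Data.Integer.Base as ℤ using (ℤ; +_; _⊖_; 0ℤ; +≤+)
  import Data.Integer.Properties as ℤₚ
  import Data.Integer.Tactic.RingSolver as ℤ-Solver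
  open import Data.List.Base using (List; []; _∷_; _++_; length; filterᵇ; map; concat; tabulate; allFin)
  open import Data.List.Properties using (map-tabulate)
  open import Data.Nat.Base using (ℕ; zero; suc; _+_; _*_; _≤_; z≤n; s≤s; _<ᵇ_)
  open import Data.Nat.Properties
    using ( +-*-semiring; +-assoc; +-comm; +-identityʳ; *-assoc; *-monoʳ-≤; *-distribˡ-+
          ; m≤m+n; m≤n+m; ≤-refl; ≤-trans; ≤-reflexive; ≤-antisym; <-asym; ≮⇒≥; <ᵇ-reflects-< )
  import Data.Nat.Tactic.RingSolver as ℕ-Solver
  open import Data.Product using (∃-syntax; _×_; _,_)
  open import Data.Sum.Base using (_⊎_; inj₁; inj₂)
  open import Data.Vec.Base using (_∷_; []; lookup)
  open import Function.Base using (_∘_; id)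
  open import Function.Bundles using (_↔_; Inverse; _⇔_; mk⇔; Equivalence)
  import Function.Properties.Equivalence as ⇔
  open import Function.Properties.Inverse using (↔-sym; ↔-trans)
  open import Relation.Binary.PropositionalEquality
  open import Relation.Nullary using (¬_; contradiction)
  open import Relation.Nullary.Decidable using (Dec; does; yes; no; True; toWitness; _×-dec_; _⊎-dec_)
  open import Relation.Nullary.Reflects using (ofʸ; ofⁿ)
  open import Algebra.Properties.Semiring.Sum +-*-semiring
    using (sum; sum-syntax; sum-cong-≗; ∑-distrib-+; ∑-comm; ∑-permute; sum-replicate-zero)

  -- Finite sums and Boolean counting

  χ : Bool → ℕ
  χ true  = 1
  χ false = 0

  sum-↑ˡ-↑ʳ : ∀ {k l} (h : Fin (k + l) → ℕ) → sum h ≡ ∑[ a < k ] h (a ↑ˡ l) + ∑[ j < l ] h (k ↑ʳ j)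
  sum-↑ˡ-↑ʳ {zero}      h = refl
  sum-↑ˡ-↑ʳ {suc k} {l} h = trans (cong₂ _+_ refl (sum-↑ˡ-↑ʳ {k} {l} (h ∘ suc))) (sym (+-assoc (h zero) _ _))

  sum-zero : ∀ {k} (h : Fin k → ℕ) → (∀ i → h i ≡ 0) → sum h ≡ 0
  sum-zero {k} h h≡0 = trans (sum-cong-≗ h≡0) (sum-replicate-zero k)

  term≤sum : ∀ {k} (h : Fin k → ℕ) (i : Fin k) → h i ≤ sum h
  term≤sum h zero    = m≤m+n _ _
  term≤sum h (suc i) = ≤-trans (term≤sum (h ∘ suc) i) (m≤n+m _ (h zero))

  sum-χ-≟ : ∀ {k} (g : Fin k → Bool) (t : Fin k) → ∑[ a < k ] χ (g a ∧ does (a ≟ t)) ≡ χ (g t)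
  sum-χ-≟ g zero    = trans (cong₂ _+_ (cong χ (∧-identityʳ (g zero)))
                                       (sum-zero _ (λ a → cong χ (∧-zeroʳ (g (suc a))))))
                            (+-identityʳ _)
  sum-χ-≟ g (suc t) = cong₂ _+_ (cong χ (∧-zeroʳ (g zero))) (sum-χ-≟ (g ∘ suc) t)

  middle-double : ∀ a c d → a + c + (c + d) ≡ a + 2 * c + d
  middle-double = ℕ-Solver.solve-∀

  ∧≡false-split : ∀ a b → a ∧ b ≡ false → a ≡ false ⊎ b ≡ false
  ∧≡false-split false b _       = inj₁ refl
  ∧≡false-split true  b b≡false = inj₂ b≡false

  ∧∧-zeroʳ : ∀ u v → u ∧ v ∧ false ≡ false
  ∧∧-zeroʳ u v = trans (cong (u ∧_) (∧-zeroʳ v)) (∧-zeroʳ u)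

  ∧-reassoc : ∀ u v p q → u ∧ v ∧ (p ∧ q) ≡ (u ∧ v ∧ p) ∧ q
  ∧-reassoc u v p q = sym (trans (∧-assoc u (v ∧ p) q) (cong (u ∧_) (∧-assoc v p q)))

  χ-∨ : ∀ u v p q → p ∧ q ≡ false → χ (u ∧ v ∧ (p ∨ q)) ≡ χ (u ∧ v ∧ p) + χ (u ∧ v ∧ q)
  χ-∨ false v     p     q     _ = refl
  χ-∨ true  false p     q     _ = refl
  χ-∨ true  true  true  true  ()
  χ-∨ true  true  true  false _ = refl
  χ-∨ true  true  false q     _ = refl

  χ-split : ∀ u v c e → (e ≡ true → c ≡ true) →
            χ (u ∧ v ∧ c) ≡ χ (u ∧ v ∧ (c ∧ not e)) + χ (u ∧ v ∧ e)
  χ-split false v     c     e     _   = refl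
  χ-split true  false c     e     _   = refl
  χ-split true  true  true  true  _   = refl
  χ-split true  true  true  false _   = refl
  χ-split true  true  false false _   = refl
  χ-split true  true  false true  e⇒c = contradiction (e⇒c refl) λ ()

  χ-cover : ∀ t w u v → (t ≡ true → w ≡ true) → χ (w ∧ u ∧ v) ≡ χ (t ∧ u ∧ v) + χ (w ∧ u ∧ v ∧ not t)
  χ-cover true  false u     v     t⇒w = contradiction (t⇒w refl) λ ()
  χ-cover true  true  false v     _   = refl
  χ-cover true  true  true  false _   = refl
  χ-cover true  true  true  true  _   = refl
  χ-cover false false u     v     _   = refl
  χ-cover false true  false v     _   = refl
  χ-cover false true  true  false _   = refl
  χ-cover false true  true  true  _   = refl

  does-true : ∀ {P : Set} (P? : Dec P) → does P? ≡ true → P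
  does-true (yes p) _ = p

  Adjacency : ℕ → Set
  Adjacency k = Fin k → Fin k → Bool

  count : ∀ {k} → (Fin k → Bool) → ℕ
  count {k} f = ∑[ i < k ] χ (f i)

  arcs : ∀ {k} → Adjacency k → (Fin k → Bool) → ℕ
  arcs {k} A f = ∑[ i < k ] ∑[ j < k ] χ (f i ∧ f j ∧ A i j)

  count-cong : ∀ {k} {f g : Fin k → Bool} → (∀ i → f i ≡ g i) → count f ≡ count g
  count-cong f≗g = sum-cong-≗ (cong χ ∘ f≗g)

  arcs-congˡ : ∀ {k} {A B : Adjacency k} (f : Fin k → Bool) → (∀ i j → A i j ≡ B i j) → arcs A f ≡ arcs B f
  arcs-congˡ f A≗B = sum-cong-≗ λ i → sum-cong-≗ λ j → cong (λ c → χ (f i ∧ f j ∧ c)) (A≗B i j)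

  arcs-congʳ : ∀ {k} (A : Adjacency k) {f g : Fin k → Bool} → (∀ i → f i ≡ g i) → arcs A f ≡ arcs A g
  arcs-congʳ A f≗g = sum-cong-≗ λ i → sum-cong-≗ λ j → cong₂ (λ u v → χ (u ∧ v ∧ A i j)) (f≗g i) (f≗g j)

  arcs-↑ˡ-↑ʳ : ∀ {k l} (A : Adjacency (k + l)) (f : Fin (k + l) → Bool) →
               (∀ a j → A (k ↑ʳ j) (a ↑ˡ l) ≡ A (a ↑ˡ l) (k ↑ʳ j)) →
               arcs A f ≡ arcs (λ a b → A (a ↑ˡ l) (b ↑ˡ l)) (f ∘ (_↑ˡ l))
                        + 2 * (∑[ a < k ] ∑[ j < l ] χ (f (a ↑ˡ l) ∧ f (k ↑ʳ j) ∧ A (a ↑ˡ l) (k ↑ʳ j)))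
                        + arcs (λ i j → A (k ↑ʳ i) (k ↑ʳ j)) (f ∘ (k ↑ʳ_))
  arcs-↑ˡ-↑ʳ {k} {l} A f A-sym = begin
    arcs A f
      ≡⟨ sum-↑ˡ-↑ʳ {k} {l} _ ⟩
    ∑[ a < k ] row (a ↑ˡ l) + ∑[ i < l ] row (k ↑ʳ i)
      ≡⟨ cong₂ _+_ (split-row (_↑ˡ l)) (split-row (k ↑ʳ_)) ⟩
    (arcs₁₁ + cross) + (∑[ i < l ] ∑[ a < k ] χ (f (k ↑ʳ i) ∧ f (a ↑ˡ l) ∧ A (k ↑ʳ i) (a ↑ˡ l)) + arcs₂₂)
      ≡⟨ cong (λ c → (arcs₁₁ + cross) + (c + arcs₂₂))
              (trans (∑-comm (λ i a → χ (f (k ↑ʳ i) ∧ f (a ↑ˡ l) ∧ A (k ↑ʳ i) (a ↑ˡ l))))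
                     (sum-cong-≗ λ a → sum-cong-≗ λ i →
                        trans (cong (λ c → χ (f (k ↑ʳ i) ∧ f (a ↑ˡ l) ∧ c)) (A-sym a i))
                              (cong χ (x∙yz≈y∙xz (f (k ↑ʳ i)) (f (a ↑ˡ l)) _)))) ⟩
    (arcs₁₁ + cross) + (cross + arcs₂₂)
      ≡⟨ middle-double arcs₁₁ cross arcs₂₂ ⟩
    arcs₁₁ + 2 * cross + arcs₂₂ ∎
    where
    open ≡-Reasoning
    row : Fin (k + l) → ℕ
    row i = ∑[ j < k + l ] χ (f i ∧ f j ∧ A i j)
    split-row : ∀ {n} (ι : Fin n → Fin (k + l)) →
                ∑[ p < n ] row (ι p) ≡ ∑[ p < n ] ∑[ b < k ] χ (f (ι p) ∧ f (b ↑ˡ l) ∧ A (ι p) (b ↑ˡ l))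
                                     + ∑[ p < n ] ∑[ j < l ] χ (f (ι p) ∧ f (k ↑ʳ j) ∧ A (ι p) (k ↑ʳ j))
    split-row ι = trans (sum-cong-≗ λ p → sum-↑ˡ-↑ʳ {k} {l} (λ j → χ (f (ι p) ∧ f j ∧ A (ι p) j)))
      (∑-distrib-+ (λ p → ∑[ b < k ] χ (f (ι p) ∧ f (b ↑ˡ l) ∧ A (ι p) (b ↑ˡ l)))
                   (λ p → ∑[ j < l ] χ (f (ι p) ∧ f (k ↑ʳ j) ∧ A (ι p) (k ↑ʳ j))))
    arcs₁₁ = arcs (λ a b → A (a ↑ˡ l) (b ↑ˡ l)) (f ∘ (_↑ˡ l))
    arcs₂₂ = arcs (λ i j → A (k ↑ʳ i) (k ↑ʳ j)) (f ∘ (k ↑ʳ_))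
    cross = ∑[ a < k ] ∑[ j < l ] χ (f (a ↑ˡ l) ∧ f (k ↑ʳ j) ∧ A (a ↑ˡ l) (k ↑ʳ j))

  arcs-split-zero : ∀ {k} (A : Adjacency (suc k)) (f : Fin (suc k) → Bool) →
                    A zero zero ≡ false → (∀ j → A (suc j) zero ≡ A zero (suc j)) →
                    arcs A f ≡ 2 * (∑[ j < k ] χ (f zero ∧ f (suc j) ∧ A zero (suc j)))
                             + arcs (λ i j → A (suc i) (suc j)) (f ∘ suc)
  arcs-split-zero {k} A f A-irr A-sym = begin
    arcs A f
      ≡⟨ cong₂ _+_ (cong (_+ nbrs) loop≡0)
                   (trans (∑-distrib-+ (λ j → χ (f (suc j) ∧ f zero ∧ A (suc j) zero))
                                       (λ j → ∑[ i < k ] χ (f (suc j) ∧ f (suc i) ∧ A (suc j) (suc i))))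
                          (cong (_+ rest) (sum-cong-≗ λ j →
                            trans (cong (λ c → χ (f (suc j) ∧ f zero ∧ c)) (A-sym j))
                                  (cong χ (x∙yz≈y∙xz (f (suc j)) (f zero) _))))) ⟩
    0 + nbrs + (nbrs + rest)
      ≡⟨ middle-double 0 nbrs rest ⟩
    2 * nbrs + rest ∎
    where
    open ≡-Reasoning
    nbrs = ∑[ j < k ] χ (f zero ∧ f (suc j) ∧ A zero (suc j))
    rest = arcs (λ i j → A (suc i) (suc j)) (f ∘ suc)
    loop≡0 : χ (f zero ∧ f zero ∧ A zero zero) ≡ 0
    loop≡0 = cong χ (trans (cong (λ c → f zero ∧ f zero ∧ c) A-irr) (∧∧-zeroʳ (f zero) (f zero)))

  edge? : ∀ {k} (x y a b : Fin k) → Dec ((a ≡ x × b ≡ y) ⊎ (a ≡ y × b ≡ x))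
  edge? x y a b = (a ≟ x ×-dec b ≟ y) ⊎-dec (a ≟ y ×-dec b ≟ x)

  removeEdge : ∀ {k} → Fin k → Fin k → Adjacency k → Adjacency k
  removeEdge x y A a b = A a b ∧ not (does (edge? x y a b))

  arcs-arc : ∀ {k} (x y : Fin k) (f : Fin k → Bool) →
             arcs (λ a b → does (a ≟ x) ∧ does (b ≟ y)) f ≡ χ (f x ∧ f y)
  arcs-arc {k} x y f = begin
    arcs (λ a b → does (a ≟ x) ∧ does (b ≟ y)) f
      ≡⟨ sum-cong-≗ (λ a → trans (sum-cong-≗ λ b → cong χ (∧-reassoc (f a) (f b) (does (a ≟ x)) (does (b ≟ y))))
                                 (sum-χ-≟ (λ b → f a ∧ f b ∧ does (a ≟ x)) y)) ⟩
    ∑[ a < k ] χ (f a ∧ f y ∧ does (a ≟ x))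
      ≡⟨ trans (sum-cong-≗ λ a → cong χ (sym (∧-assoc (f a) (f y) (does (a ≟ x)))))
               (sum-χ-≟ (λ a → f a ∧ f y) x) ⟩
    χ (f x ∧ f y) ∎
    where open ≡-Reasoning

  arcs-edge : ∀ {k} {x y : Fin k} → x ≢ y → (f : Fin k → Bool) →
              arcs (λ a b → does (edge? x y a b)) f ≡ 2 * χ (f x ∧ f y)
  arcs-edge {k} {x} {y} x≢y f = begin
    arcs (λ a b → does (edge? x y a b)) f
      ≡⟨ sum-cong-≗ (λ a → trans (sum-cong-≗ λ b → χ-∨ (f a) (f b) _ _ (disjoint a b))
                                 (∑-distrib-+ (λ b → χ (f a ∧ f b ∧ (does (a ≟ x) ∧ does (b ≟ y))))
                                              (λ b → χ (f a ∧ f b ∧ (does (a ≟ y) ∧ does (b ≟ x)))))) ⟩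
    ∑[ a < k ] (∑[ b < k ] χ (f a ∧ f b ∧ (does (a ≟ x) ∧ does (b ≟ y)))
              + ∑[ b < k ] χ (f a ∧ f b ∧ (does (a ≟ y) ∧ does (b ≟ x))))
      ≡⟨ ∑-distrib-+ (λ a → ∑[ b < k ] χ (f a ∧ f b ∧ (does (a ≟ x) ∧ does (b ≟ y))))
                     (λ a → ∑[ b < k ] χ (f a ∧ f b ∧ (does (a ≟ y) ∧ does (b ≟ x)))) ⟩
    arcs (λ a b → does (a ≟ x) ∧ does (b ≟ y)) f + arcs (λ a b → does (a ≟ y) ∧ does (b ≟ x)) f
      ≡⟨ cong₂ _+_ (arcs-arc x y f) (arcs-arc y x f) ⟩
    χ (f x ∧ f y) + χ (f y ∧ f x)
      ≡⟨ cong₂ _+_ refl (trans (cong χ (∧-comm (f y) (f x))) (sym (+-identityʳ _))) ⟩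
    2 * χ (f x ∧ f y) ∎
    where
    open ≡-Reasoning
    disjoint : ∀ a b → (does (a ≟ x) ∧ does (b ≟ y)) ∧ (does (a ≟ y) ∧ does (b ≟ x)) ≡ false
    disjoint a b with a ≟ x | a ≟ y
    ... | yes refl | yes refl = contradiction refl x≢y
    ... | yes _    | no _     = ∧-zeroʳ (does (b ≟ y))
    ... | no _     | _        = refl

  arcs-removeEdge : ∀ {k} {A : Adjacency k} {x y : Fin k} → x ≢ y → A x y ≡ true → A y x ≡ true →
                    (f : Fin k → Bool) → arcs A f ≡ arcs (removeEdge x y A) f + 2 * χ (f x ∧ f y)
  arcs-removeEdge {k} {A} {x} {y} x≢y Axy Ayx f = begin
    arcs A f
      ≡⟨ sum-cong-≗ (λ a → trans (sum-cong-≗ λ b → χ-split (f a) (f b) (A a b) _ (edge⇒adjacent a b))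
                                 (∑-distrib-+ (λ b → χ (f a ∧ f b ∧ removeEdge x y A a b))
                                              (λ b → χ (f a ∧ f b ∧ does (edge? x y a b))))) ⟩
    ∑[ a < k ] (∑[ b < k ] χ (f a ∧ f b ∧ removeEdge x y A a b) + ∑[ b < k ] χ (f a ∧ f b ∧ does (edge? x y a b)))
      ≡⟨ ∑-distrib-+ (λ a → ∑[ b < k ] χ (f a ∧ f b ∧ removeEdge x y A a b))
                     (λ a → ∑[ b < k ] χ (f a ∧ f b ∧ does (edge? x y a b))) ⟩
    arcs (removeEdge x y A) f + arcs (λ a b → does (edge? x y a b)) f
      ≡⟨ cong₂ _+_ refl (arcs-edge x≢y f) ⟩
    arcs (removeEdge x y A) f + 2 * χ (f x ∧ f y) ∎
    where
    open ≡-Reasoning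
    edge⇒adjacent : ∀ a b → does (edge? x y a b) ≡ true → A a b ≡ true
    edge⇒adjacent a b e with does-true (edge? x y a b) e
    ... | inj₁ (refl , refl) = Axy
    ... | inj₂ (refl , refl) = Ayx

  module _ {k l} (π : Fin k ↔ Fin l) where
    open Inverse π using (to; from; strictlyInverseʳ)

    count-reindex : (f : Fin k → Bool) → count (f ∘ from) ≡ count f
    count-reindex f = trans (∑-permute _ π) (sum-cong-≗ λ u → cong (χ ∘ f) (strictlyInverseʳ u))

    arcs-reindex : {A : Adjacency k} {B : Adjacency l} → (∀ u v → A u v ≡ B (to u) (to v)) →
                   (f : Fin k → Bool) → arcs B (f ∘ from) ≡ arcs A f
    arcs-reindex {A} {B} A≅B f = trans (∑-permute _ π) (sum-cong-≗ λ u → trans (∑-permute _ π) (sum-cong-≗ λ v →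
      trans (cong₂ (λ p q → χ (f p ∧ f q ∧ B (to u) (to v))) (strictlyInverseʳ u) (strictlyInverseʳ v))
            (cong (λ c → χ (f u ∧ f v ∧ c)) (sym (A≅B u v)))))

  -- The potential and the gap invariant

  -- Twice ρ₃: arcs counts each edge of the induced subgraph once in each direction.
  potential : ∀ {k} → Adjacency k → (Fin k → Bool) → ℤ
  potential A f = 16 * count f ⊖ 5 * arcs A f

  full : ∀ {k} → Fin k → Bool
  full _ = true

  record PotentialGap {k} (A : Adjacency k) : Set where
    field
      potential-full : potential A full ℤ.≤ + 4
      gap            : ∀ f → ∃[ i ] f i ≡ true → ∃[ j ] f j ≡ false →
                       potential A full ℤ.+ + 12 ℤ.≤ potential A f

  potential-cong : ∀ {k} (A : Adjacency k) {f g : Fin k → Bool} → (∀ i → f i ≡ g i) → potential A f ≡ potential A g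
  potential-cong A f≗g = cong₂ (λ c a → 16 * c ⊖ 5 * a) (count-cong f≗g) (arcs-congʳ A f≗g)

  potential-empty : ∀ {k} (A : Adjacency k) {f : Fin k → Bool} → (∀ i → f i ≡ false) → potential A f ≡ 0ℤ
  potential-empty A {f} f≡false = cong₂ (λ c a → 16 * c ⊖ 5 * a)
    (sum-zero _ λ i → cong χ (f≡false i))
    (sum-zero _ λ i → sum-zero _ λ j → cong (λ b → χ (b ∧ f j ∧ A i j)) (f≡false i))

  PotentialGap-reindex : ∀ {k l} (π : Fin k ↔ Fin l) {A : Adjacency k} {B : Adjacency l} →
                         (∀ u v → A u v ≡ B (Inverse.to π u) (Inverse.to π v)) → PotentialGap B → PotentialGap A
  PotentialGap-reindex π {A} {B} A≅B gapB = record
    { potential-full = subst (ℤ._≤ + 4) (potential≡ full) (PotentialGap.potential-full gapB)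
    ; gap = λ f (i , fi) (j , fj) → subst₂ (λ p q → p ℤ.+ + 12 ℤ.≤ q) (potential≡ full) (potential≡ f)
        (PotentialGap.gap gapB (f ∘ from) (to i , trans (cong f (strictlyInverseʳ i)) fi)
                                          (to j , trans (cong f (strictlyInverseʳ j)) fj))
    }
    where
    open Inverse π using (to; from; strictlyInverseʳ)
    potential≡ : ∀ f → potential B (f ∘ from) ≡ potential A f
    potential≡ f = cong₂ (λ c a → 16 * c ⊖ 5 * a) (count-reindex π f) (arcs-reindex π A≅B f)

  data Extent {k} (f : Fin k → Bool) : Set where
    isEmpty  : (∀ i → f i ≡ false) → Extent f
    isFull   : (∀ i → f i ≡ true) → Extent f
    isProper : ∃[ i ] f i ≡ true → ∃[ j ] f j ≡ false → Extent f

  extent : ∀ {k} (f : Fin k → Bool) → Extent f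
  extent f with any? (λ i → f i ≟ᵇ true) | any? (λ i → f i ≟ᵇ false)
  ... | yes t | yes u = isProper t u
  ... | no ¬t | _     = isEmpty (λ i → ¬-not (¬t ∘ (i ,_)))
  ... | yes _ | no ¬u = isFull (λ i → ¬-not (¬u ∘ (i ,_)))

  bonus : ∀ {k} {f : Fin k → Bool} → Extent f → ℤ
  bonus (isEmpty _)    = 0ℤ
  bonus (isFull _)     = + 4
  bonus (isProper _ _) = + 16

  potential-bound : ∀ {k} {A : Adjacency k} {f : Fin k → Bool} → PotentialGap A → (e : Extent f) →
                    potential A full ℤ.+ bonus e ℤ.≤ potential A f ℤ.+ + 4
  potential-bound {A = A} g (isEmpty f≡false)
    rewrite potential-empty A f≡false | ℤₚ.+-identityʳ (potential A full) = PotentialGap.potential-full g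
  potential-bound {A = A} g (isFull f≡true) =
    ℤₚ.≤-reflexive (cong (ℤ._+ + 4) (potential-cong A (sym ∘ f≡true)))
  potential-bound {A = A} {f} g (isProper t u) =
    ℤₚ.≤-trans (ℤₚ.≤-reflexive (sym (ℤₚ.+-assoc (potential A full) (+ 12) (+ 4))))
               (ℤₚ.+-monoˡ-≤ (+ 4) (PotentialGap.gap g f t u))

  ⊖-balance : ∀ a b c d → a + d ≡ c + b → a ⊖ b ≡ c ⊖ d
  ⊖-balance a b c d a+d≡c+b = begin
    a ⊖ b             ≡⟨ ℤₚ.+-cancelˡ-⊖ d a b ⟨
    (d + a) ⊖ (d + b) ≡⟨ cong₂ _⊖_ (trans (+-comm d a) (trans a+d≡c+b (+-comm c b))) (+-comm d b) ⟩
    (b + c) ⊖ (b + d) ≡⟨ ℤₚ.+-cancelˡ-⊖ b c d ⟩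
    c ⊖ d             ∎
    where open ≡-Reasoning

  ⊖-+-⊖ : ∀ a b c d → (a ⊖ b) ℤ.+ (c ⊖ d) ≡ (a + c) ⊖ (b + d)
  ⊖-+-⊖ a b c d = begin
    (a ⊖ b) ℤ.+ (c ⊖ d)             ≡⟨ cong₂ ℤ._+_ (ℤₚ.[+m]-[+n]≡m⊖n a b) (ℤₚ.[+m]-[+n]≡m⊖n c d) ⟨
    (+ a ℤ.- + b) ℤ.+ (+ c ℤ.- + d) ≡⟨ regroup (+ a) (+ b) (+ c) (+ d) ⟩
    (+ a ℤ.+ + c) ℤ.- (+ b ℤ.+ + d) ≡⟨ cong₂ ℤ._-_ (ℤₚ.pos-+ a c) (ℤₚ.pos-+ b d) ⟨
    + (a + c) ℤ.- + (b + d)         ≡⟨ ℤₚ.[+m]-[+n]≡m⊖n (a + c) (b + d) ⟩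
    (a + c) ⊖ (b + d)               ∎
    where
    open ≡-Reasoning
    regroup : ∀ p q r s → (p ℤ.- q) ℤ.+ (r ℤ.- s) ≡ (p ℤ.+ r) ℤ.- (q ℤ.+ s)
    regroup = ℤ-Solver.solve-∀

  +-cancelʳ-≤ : ∀ i j k → i ℤ.+ k ℤ.≤ j ℤ.+ k → i ℤ.≤ j
  +-cancelʳ-≤ i j k i+k≤j+k = subst₂ ℤ._≤_ (cancel i k) (cancel j k) (ℤₚ.+-monoˡ-≤ (ℤ.- k) i+k≤j+k)
    where
    cancel : ∀ a b → a ℤ.+ b ℤ.- b ≡ a
    cancel = ℤ-Solver.solve-∀

  by-decision : ∀ {p q} → True (p ℤₚ.≤? q) → p ℤ.≤ q
  by-decision = toWitness

  gap-from-bounds : ∀ {W F P₁ P₂ Q₁ Q₂ b₁ b₂ L} →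
                    W ℤ.+ + 6 ≡ P₁ ℤ.+ P₂ → F ℤ.+ L ≡ Q₁ ℤ.+ Q₂ →
                    P₁ ℤ.+ b₁ ℤ.≤ Q₁ ℤ.+ + 4 → P₂ ℤ.+ b₂ ℤ.≤ Q₂ ℤ.+ + 4 →
                    + 14 ℤ.+ L ℤ.≤ b₁ ℤ.+ b₂ →
                    W ℤ.+ + 12 ℤ.≤ F
  gap-from-bounds {W} {F} {P₁} {P₂} {Q₁} {Q₂} {b₁} {b₂} {L} whole part bound₁ bound₂ loss≤bonus =
    +-cancelʳ-≤ (W ℤ.+ + 12) F (L ℤ.+ + 8) (begin
      (W ℤ.+ + 12) ℤ.+ (L ℤ.+ + 8)  ≡⟨ regroup₁ W L ⟩
      (W ℤ.+ + 6) ℤ.+ (+ 14 ℤ.+ L)  ≤⟨ ℤₚ.+-monoʳ-≤ (W ℤ.+ + 6) loss≤bonus ⟩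
      (W ℤ.+ + 6) ℤ.+ (b₁ ℤ.+ b₂)   ≡⟨ cong (ℤ._+ (b₁ ℤ.+ b₂)) whole ⟩
      (P₁ ℤ.+ P₂) ℤ.+ (b₁ ℤ.+ b₂)   ≡⟨ regroup₂ P₁ P₂ b₁ b₂ ⟩
      (P₁ ℤ.+ b₁) ℤ.+ (P₂ ℤ.+ b₂)   ≤⟨ ℤₚ.+-mono-≤ bound₁ bound₂ ⟩
      (Q₁ ℤ.+ + 4) ℤ.+ (Q₂ ℤ.+ + 4) ≡⟨ regroup₃ Q₁ Q₂ ⟩
      (Q₁ ℤ.+ Q₂) ℤ.+ + 8           ≡⟨ cong (ℤ._+ + 8) part ⟨
      (F ℤ.+ L) ℤ.+ + 8             ≡⟨ ℤₚ.+-assoc F L (+ 8) ⟩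
      F ℤ.+ (L ℤ.+ + 8)             ∎)
    where
    open ℤₚ.≤-Reasoning
    regroup₁ : ∀ w l → (w ℤ.+ + 12) ℤ.+ (l ℤ.+ + 8) ≡ (w ℤ.+ + 6) ℤ.+ (+ 14 ℤ.+ l)
    regroup₁ = ℤ-Solver.solve-∀
    regroup₂ : ∀ p₁ p₂ c₁ c₂ → (p₁ ℤ.+ p₂) ℤ.+ (c₁ ℤ.+ c₂) ≡ (p₁ ℤ.+ c₁) ℤ.+ (p₂ ℤ.+ c₂)
    regroup₂ = ℤ-Solver.solve-∀
    regroup₃ : ∀ q₁ q₂ → (q₁ ℤ.+ + 4) ℤ.+ (q₂ ℤ.+ + 4) ≡ (q₁ ℤ.+ q₂) ℤ.+ + 8
    regroup₃ = ℤ-Solver.solve-∀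

  K4-gap : PotentialGap (adj K4)
  K4-gap = record
    { potential-full = ℤₚ.≤-refl
    ; gap = λ f (i , fi) (j , fj) →
        subst (potential (adj K4) full ℤ.+ + 12 ℤ.≤_) (potential-cong (adj K4) (sym ∘ listed f))
              (table (f 0F) (f 1F) (f 2F) (f 3F) (i , trans (sym (listed f i)) fi) (j , trans (sym (listed f j)) fj))
    }
    where
    listed : (f : Fin 4 → Bool) → ∀ i → f i ≡ lookup (f 0F ∷ f 1F ∷ f 2F ∷ f 3F ∷ []) i
    listed f 0F = refl
    listed f 1F = refl
    listed f 2F = refl
    listed f 3F = refl

    table : ∀ a b c d → let f = lookup (a ∷ b ∷ c ∷ d ∷ []) in ∃[ i ] f i ≡ true → ∃[ j ] f j ≡ false →
            potential (adj K4) full ℤ.+ + 12 ℤ.≤ potential (adj K4) f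
    table false false false false (0F , ()) _
    table false false false false (1F , ()) _
    table false false false false (2F , ()) _
    table false false false false (3F , ()) _
    table true  true  true  true  _ (0F , ())
    table true  true  true  true  _ (1F , ())
    table true  true  true  true  _ (2F , ())
    table true  true  true  true  _ (3F , ())
    table false false false true  _ _ = by-decision _
    table false false true  false _ _ = by-decision _
    table false false true  true  _ _ = by-decision _
    table false true  false false _ _ = by-decision _
    table false true  false true  _ _ = by-decision _
    table false true  true  false _ _ = by-decision _
    table false true  true  true  _ _ = by-decision _
    table true  false false false _ _ = by-decision _
    table true  false false true  _ _ = by-decision _
    table true  false true  false _ _ = by-decision _
    table true  false true  true  _ _ = by-decision _
    table true  true  false false _ _ = by-decision _
    table true  true  false true  _ _ = by-decision _
    table true  true  true  false _ _ = by-decision _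

  -- DHGO-compositions

  -- The defect p₁(S₁) + p₂(S₂) − p_H(S) of a composition, in the notation of the header.
  splitLoss : Bool → Bool → ℕ → ℤ
  splitLoss z∈ xy∈ missing = 16 * χ z∈ ⊖ (10 * χ xy∈ + 10 * missing)

  splitLoss-arith : ∀ c₁ c₂ a₁ a₂ C M z e →
    (16 * (c₁ + c₂) ⊖ 5 * (a₁ + 2 * C + a₂)) ℤ.+ splitLoss z e M
      ≡ (16 * c₁ ⊖ 5 * (a₁ + 2 * χ e)) ℤ.+ (16 * (χ z + c₂) ⊖ 5 * (2 * (C + M) + a₂))
  splitLoss-arith c₁ c₂ a₁ a₂ C M z e = begin
    (s⁺ ⊖ s⁻) ℤ.+ (l⁺ ⊖ l⁻) ≡⟨ ⊖-+-⊖ s⁺ s⁻ l⁺ l⁻ ⟩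
    (s⁺ + l⁺) ⊖ (s⁻ + l⁻)   ≡⟨ ⊖-balance (s⁺ + l⁺) (s⁻ + l⁻) (p⁺ + q⁺) (p⁻ + q⁻)
                                         (balance c₁ c₂ a₁ a₂ C M (χ z) (χ e)) ⟩
    (p⁺ + q⁺) ⊖ (p⁻ + q⁻)   ≡⟨ ⊖-+-⊖ p⁺ p⁻ q⁺ q⁻ ⟨
    (p⁺ ⊖ p⁻) ℤ.+ (q⁺ ⊖ q⁻) ∎
    where
    open ≡-Reasoning
    s⁺ = 16 * (c₁ + c₂)
    s⁻ = 5 * (a₁ + 2 * C + a₂)
    l⁺ = 16 * χ z
    l⁻ = 10 * χ e + 10 * M
    p⁺ = 16 * c₁
    p⁻ = 5 * (a₁ + 2 * χ e)
    q⁺ = 16 * (χ z + c₂)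
    q⁻ = 5 * (2 * (C + M) + a₂)
    balance : ∀ c₁ c₂ a₁ a₂ C M Z E →
      16 * (c₁ + c₂) + 16 * Z + (5 * (a₁ + 2 * E) + 5 * (2 * (C + M) + a₂))
        ≡ 16 * c₁ + 16 * (Z + c₂) + (5 * (a₁ + 2 * C + a₂) + (10 * E + 10 * M))
    balance = ℕ-Solver.solve-∀

  splitLoss≤16 : ∀ z e M → splitLoss z e M ℤ.≤ + 16
  splitLoss≤16 true  e M = ℤₚ.m⊖n≤m 16 (10 * χ e + 10 * M)
  splitLoss≤16 false e M = ℤₚ.≤-trans (ℤₚ.m⊖n≤m 0 (10 * χ e + 10 * M)) (+≤+ z≤n)

  splitLoss-false≤0 : ∀ e M → splitLoss false e M ℤ.≤ 0ℤ
  splitLoss-false≤0 e M = ℤₚ.0⊖m≤+ (10 * χ e + 10 * M)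

  splitLoss≤6 : ∀ z e M → 1 ≤ χ e + M → splitLoss z e M ℤ.≤ + 6
  splitLoss≤6 z e M 1≤e+M = ℤₚ.≤-trans (ℤₚ.⊖-monoˡ-≤ (10 * χ e + 10 * M) (16χ≤16 z))
    (ℤₚ.⊖-monoʳ-≥-≤ 16 (≤-trans (*-monoʳ-≤ 10 1≤e+M) (≤-reflexive (*-distribˡ-+ 10 (χ e) M))))
    where
    16χ≤16 : ∀ b → 16 * χ b ≤ 16
    16χ≤16 true  = ≤-refl
    16χ≤16 false = z≤n

  -- The composition of A₁ (edge xy deleted) and A₂ (vertex zero split) on Fin n₁ ⊎ Fin m, where
  -- j : Fin m stands for the vertex suc j of A₂ and a neighbour j of zero is joined to x if
  -- side j and to y otherwise.
  module Composition {n₁ m : ℕ} (A₁ : Adjacency n₁) (A₂ : Adjacency (suc m)) (x y : Fin n₁) (side : Fin m → Bool)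
    (x≢y : x ≢ y) (A₁xy : A₁ x y ≡ true) (A₁yx : A₁ y x ≡ true)
    (A₂-irr : A₂ zero zero ≡ false) (A₂-sym : ∀ j → A₂ (suc j) zero ≡ A₂ zero (suc j)) where

    target : Fin m → Fin n₁
    target j = if side j then x else y

    adjZ : Fin m → Bool
    adjZ j = A₂ zero (suc j)

    composite : Fin n₁ ⊎ Fin m → Fin n₁ ⊎ Fin m → Bool
    composite (inj₁ a) (inj₁ b) = removeEdge x y A₁ a b
    composite (inj₁ a) (inj₂ j) = adjZ j ∧ does (a ≟ target j)
    composite (inj₂ j) (inj₁ a) = adjZ j ∧ does (a ≟ target j)
    composite (inj₂ j) (inj₂ k) = A₂ (suc j) (suc k)

    Aᶜ : Adjacency (n₁ + m)
    Aᶜ i j = composite (splitAt n₁ i) (splitAt n₁ j)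

    Aᶜ-join : ∀ p q → Aᶜ (join n₁ m p) (join n₁ m q) ≡ composite p q
    Aᶜ-join p q = cong₂ composite (splitAt-join n₁ m p) (splitAt-join n₁ m q)

    module _ (f : Fin (n₁ + m) → Bool) where

      f₁ : Fin n₁ → Bool
      f₁ = f ∘ (_↑ˡ m)

      f₂ : Fin m → Bool
      f₂ = f ∘ (n₁ ↑ʳ_)

      merged : Bool
      merged = f₁ x ∨ f₁ y

      f₂⁺ : Fin (suc m) → Bool
      f₂⁺ zero    = merged
      f₂⁺ (suc j) = f₂ j

      kept : ℕ
      kept = ∑[ j < m ] χ (f₁ (target j) ∧ f₂ j ∧ adjZ j)

      missing : ℕ
      missing = ∑[ j < m ] χ (merged ∧ f₂ j ∧ adjZ j ∧ not (f₁ (target j)))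

      loss : ℤ
      loss = splitLoss merged (f₁ x ∧ f₁ y) missing

      split-witness : ∀ {b} → ∃[ i ] f i ≡ b → (∃[ a ] f₁ a ≡ b) ⊎ (∃[ j ] f₂ j ≡ b)
      split-witness (i , fi) with splitAt n₁ i in eq
      ... | inj₁ a = inj₁ (a , trans (cong f (splitAt⁻¹-↑ˡ eq)) fi)
      ... | inj₂ j = inj₂ (j , trans (cong f (splitAt⁻¹-↑ʳ eq)) fi)

      arcs-composite : arcs Aᶜ f ≡ arcs (removeEdge x y A₁) f₁ + 2 * kept + arcs (λ i j → A₂ (suc i) (suc j)) f₂
      arcs-composite =
        trans (arcs-↑ˡ-↑ʳ Aᶜ f (λ a j → trans (Aᶜ-join (inj₂ j) (inj₁ a)) (sym (Aᶜ-join (inj₁ a) (inj₂ j)))))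
              (cong₂ _+_ (cong₂ _+_ (arcs-congˡ f₁ λ a b → Aᶜ-join (inj₁ a) (inj₁ b)) (cong (2 *_) cross))
                         (arcs-congˡ f₂ λ i j → Aᶜ-join (inj₂ i) (inj₂ j)))
        where
        cross : ∑[ a < n₁ ] ∑[ j < m ] χ (f₁ a ∧ f₂ j ∧ Aᶜ (a ↑ˡ m) (n₁ ↑ʳ j)) ≡ kept
        cross = begin
          ∑[ a < n₁ ] ∑[ j < m ] χ (f₁ a ∧ f₂ j ∧ Aᶜ (a ↑ˡ m) (n₁ ↑ʳ j))
            ≡⟨ ∑-comm (λ a j → χ (f₁ a ∧ f₂ j ∧ Aᶜ (a ↑ˡ m) (n₁ ↑ʳ j))) ⟩
          ∑[ j < m ] ∑[ a < n₁ ] χ (f₁ a ∧ f₂ j ∧ Aᶜ (a ↑ˡ m) (n₁ ↑ʳ j))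
            ≡⟨ sum-cong-≗ (λ j → trans (sum-cong-≗ λ a →
                 cong χ (trans (cong (λ c → f₁ a ∧ f₂ j ∧ c) (Aᶜ-join (inj₁ a) (inj₂ j)))
                               (∧-reassoc (f₁ a) (f₂ j) (adjZ j) _)))
                 (sum-χ-≟ (λ a → f₁ a ∧ f₂ j ∧ adjZ j) (target j))) ⟩
          kept ∎
          where open ≡-Reasoning

      merged-row : ∑[ j < m ] χ (merged ∧ f₂ j ∧ adjZ j) ≡ kept + missing
      merged-row = trans (sum-cong-≗ λ j → χ-cover (f₁ (target j)) merged (f₂ j) (adjZ j) (target⇒merged (side j)))
                         (∑-distrib-+ (λ j → χ (f₁ (target j) ∧ f₂ j ∧ adjZ j))
                                      (λ j → χ (merged ∧ f₂ j ∧ adjZ j ∧ not (f₁ (target j)))))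
        where
        target⇒merged : ∀ s → f₁ (if s then x else y) ≡ true → merged ≡ true
        target⇒merged true  x∈ = cong (_∨ f₁ y) x∈
        target⇒merged false y∈ = trans (cong (f₁ x ∨_) y∈) (∨-zeroʳ (f₁ x))

      potential-split : potential Aᶜ f ℤ.+ loss ≡ potential A₁ f₁ ℤ.+ potential A₂ f₂⁺
      potential-split = begin
        potential Aᶜ f ℤ.+ loss
          ≡⟨ cong₂ (λ c a → (16 * c ⊖ 5 * a) ℤ.+ loss) (sum-↑ˡ-↑ʳ {n₁} {m} (χ ∘ f)) arcs-composite ⟩
        (16 * (count f₁ + count f₂) ⊖ 5 * (arcs A₁⁻ f₁ + 2 * kept + arcs A₂⁻ f₂)) ℤ.+ loss
          ≡⟨ splitLoss-arith (count f₁) (count f₂) (arcs A₁⁻ f₁) (arcs A₂⁻ f₂)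
                             kept missing merged (f₁ x ∧ f₁ y) ⟩
        (16 * count f₁ ⊖ 5 * (arcs A₁⁻ f₁ + 2 * χ (f₁ x ∧ f₁ y)))
          ℤ.+ (16 * count f₂⁺ ⊖ 5 * (2 * (kept + missing) + arcs A₂⁻ f₂))
          ≡⟨ cong₂ ℤ._+_ (cong (λ a → 16 * count f₁ ⊖ 5 * a) (arcs-removeEdge x≢y A₁xy A₁yx f₁))
                         (cong (λ a → 16 * count f₂⁺ ⊖ 5 * a) arcs-f₂⁺) ⟨
        potential A₁ f₁ ℤ.+ potential A₂ f₂⁺ ∎
        where
        open ≡-Reasoning
        A₁⁻ = removeEdge x y A₁
        A₂⁻ = λ i j → A₂ (suc i) (suc j)
        arcs-f₂⁺ : arcs A₂ f₂⁺ ≡ 2 * (kept + missing) + arcs A₂⁻ f₂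
        arcs-f₂⁺ = trans (arcs-split-zero A₂ f₂⁺ A₂-irr A₂-sym) (cong (λ w → 2 * w + arcs A₂⁻ f₂) merged-row)

      missing-term : ∀ j → merged ≡ true → f₂ j ≡ true → adjZ j ≡ true → f₁ (target j) ≡ false → 1 ≤ missing
      missing-term j z∈ j∈ j∼z t∉ = subst (_≤ missing) term≡1 (term≤sum _ j)
        where
        term≡1 : χ (merged ∧ f₂ j ∧ adjZ j ∧ not (f₁ (target j))) ≡ 1
        term≡1 rewrite z∈ | j∈ | j∼z | t∉ = refl

      loss≤0 : merged ≡ false → loss ℤ.≤ 0ℤ
      loss≤0 z∉ = subst (λ z → splitLoss z (f₁ x ∧ f₁ y) missing ℤ.≤ 0ℤ) (sym z∉)
                        (splitLoss-false≤0 (f₁ x ∧ f₁ y) missing)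

    potential-full-split : potential Aᶜ full ℤ.+ + 6 ≡ potential A₁ full ℤ.+ potential A₂ full
    potential-full-split = begin
      potential Aᶜ full ℤ.+ + 6
        ≡⟨ cong (λ M → potential Aᶜ full ℤ.+ splitLoss true true M) nothing-missing ⟨
      potential Aᶜ full ℤ.+ loss full
        ≡⟨ potential-split full ⟩
      potential A₁ full ℤ.+ potential A₂ (f₂⁺ full)
        ≡⟨ cong (λ p → potential A₁ full ℤ.+ p) (potential-cong A₂ f₂⁺-full) ⟩
      potential A₁ full ℤ.+ potential A₂ full ∎
      where
      open ≡-Reasoning
      nothing-missing : missing full ≡ 0
      nothing-missing = sum-zero _ λ j → cong χ (∧-zeroʳ (adjZ j))
      f₂⁺-full : ∀ i → f₂⁺ full i ≡ full i
      f₂⁺-full zero    = refl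
      f₂⁺-full (suc _) = refl

    module _ (U₁ : ∃[ j ] (adjZ j ≡ true × side j ≡ true)) (U₂ : ∃[ j ] (adjZ j ≡ true × side j ≡ false)) where

      missing-positive : ∀ f → (∀ i → f₂⁺ f i ≡ true) → f₁ f x ∧ f₁ f y ≡ false → 1 ≤ missing f
      missing-positive f all∈ not-both with ∧≡false-split (f₁ f x) (f₁ f y) not-both
      ... | inj₁ x∉ = let (j , j∼z , sj) = U₁ in
        missing-term f j (all∈ zero) (all∈ (suc j)) j∼z (trans (cong (λ s → f₁ f (if s then x else y)) sj) x∉)
      ... | inj₂ y∉ = let (j , j∼z , sj) = U₂ in
        missing-term f j (all∈ zero) (all∈ (suc j)) j∼z (trans (cong (λ s → f₁ f (if s then x else y)) sj) y∉)

      loss≤6 : ∀ f → (f₁ f x ∧ f₁ f y ≡ true) ⊎ (∀ i → f₂⁺ f i ≡ true) → loss f ℤ.≤ + 6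
      loss≤6 f h = splitLoss≤6 (merged f) (f₁ f x ∧ f₁ f y) (missing f) (both-or-missing h)
        where
        both-or-missing : (f₁ f x ∧ f₁ f y ≡ true) ⊎ (∀ i → f₂⁺ f i ≡ true) →
                          1 ≤ χ (f₁ f x ∧ f₁ f y) + missing f
        both-or-missing h with f₁ f x ∧ f₁ f y in both
        ... | true = s≤s z≤n
        ... | false with h
        ...   | inj₂ all∈ = missing-positive f all∈ both

      loss-bound : ∀ f → ∃[ i ] f i ≡ true → ∃[ j ] f j ≡ false →
                   (e₁ : Extent (f₁ f)) (e₂ : Extent (f₂⁺ f)) → + 14 ℤ.+ loss f ℤ.≤ bonus e₁ ℤ.+ bonus e₂
      loss-bound f some∈ _ (isEmpty none₁) (isEmpty none₂) with split-witness f some∈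
      ... | inj₁ (a , a∈) = contradiction (trans (sym (none₁ a)) a∈) λ ()
      ... | inj₂ (j , j∈) = contradiction (trans (sym (none₂ (suc j))) j∈) λ ()
      loss-bound f _ _ (isEmpty none₁) (isFull all₂) =
        contradiction (trans (sym (cong₂ _∨_ (none₁ x) (none₁ y))) (all₂ zero)) λ ()
      loss-bound f _ _ (isEmpty none₁) (isProper _ _) =
        ℤₚ.≤-trans (ℤₚ.+-monoʳ-≤ (+ 14) (loss≤0 f (cong₂ _∨_ (none₁ x) (none₁ y)))) (by-decision _)
      loss-bound f _ _ (isFull all₁) (isEmpty none₂) =
        contradiction (trans (sym (cong₂ _∨_ (all₁ x) (all₁ y))) (none₂ zero)) λ ()
      loss-bound f _ some∉ (isFull all₁) (isFull all₂) with split-witness f some∉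
      ... | inj₁ (a , a∉) = contradiction (trans (sym (all₁ a)) a∉) λ ()
      ... | inj₂ (j , j∉) = contradiction (trans (sym (all₂ (suc j))) j∉) λ ()
      loss-bound f _ _ (isFull all₁) (isProper _ _) =
        ℤₚ.≤-trans (ℤₚ.+-monoʳ-≤ (+ 14) (loss≤6 f (inj₁ (cong₂ _∧_ (all₁ x) (all₁ y))))) (by-decision _)
      loss-bound f _ _ (isProper _ _) (isEmpty none₂) =
        ℤₚ.≤-trans (ℤₚ.+-monoʳ-≤ (+ 14) (loss≤0 f (none₂ zero))) (by-decision _)
      loss-bound f _ _ (isProper _ _) (isFull all₂) =
        ℤₚ.≤-trans (ℤₚ.+-monoʳ-≤ (+ 14) (loss≤6 f (inj₂ all₂))) (by-decision _)
      loss-bound f _ _ (isProper _ _) (isProper _ _) =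
        ℤₚ.≤-trans (ℤₚ.+-monoʳ-≤ (+ 14) (splitLoss≤16 (merged f) (f₁ f x ∧ f₁ f y) (missing f))) (by-decision _)

      composition-gap : PotentialGap A₁ → PotentialGap A₂ → PotentialGap Aᶜ
      composition-gap gap₁ gap₂ = record
        { potential-full = +-cancelʳ-≤ _ _ (+ 6) (ℤₚ.≤-trans (ℤₚ.≤-reflexive potential-full-split)
            (ℤₚ.≤-trans (ℤₚ.+-mono-≤ (PotentialGap.potential-full gap₁) (PotentialGap.potential-full gap₂))
                        (by-decision _)))
        ; gap = λ f some∈ some∉ → gap-via f some∈ some∉ (extent (f₁ f)) (extent (f₂⁺ f))
        }
        where
        gap-via : ∀ f → ∃[ i ] f i ≡ true → ∃[ j ] f j ≡ false → Extent (f₁ f) → Extent (f₂⁺ f) →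
                  potential Aᶜ full ℤ.+ + 12 ℤ.≤ potential Aᶜ f
        gap-via f some∈ some∉ e₁ e₂ =
          gap-from-bounds {potential Aᶜ full} {potential Aᶜ f} {potential A₁ full} {potential A₂ full}
                          {potential A₁ (f₁ f)} {potential A₂ (f₂⁺ f)} {bonus e₁} {bonus e₂} {loss f}
            potential-full-split (potential-split f) (potential-bound gap₁ e₁) (potential-bound gap₂ e₂)
            (loss-bound f some∈ some∉ e₁ e₂)

  Bool-ext : ∀ {a b} → (a ≡ true ⇔ b ≡ true) → a ≡ b
  Bool-ext {true}  {true}  _ = refl
  Bool-ext {true}  {false} h = sym (Equivalence.to h refl)
  Bool-ext {false} {true}  h = Equivalence.from h refl
  Bool-ext {false} {false} _ = refl

  ∧-not-does-⇔ : ∀ c {D : Set} (D? : Dec D) → (c ∧ not (does D?) ≡ true) ⇔ (c ≡ true × ¬ D)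
  ∧-not-does-⇔ c (yes d) =
    mk⇔ (λ e → contradiction (trans (sym (∧-zeroʳ c)) e) λ ()) (λ (_ , ¬d) → contradiction d ¬d)
  ∧-not-does-⇔ c (no ¬d) = mk⇔ (λ e → trans (sym (∧-identityʳ c)) e , ¬d) (λ (e , _) → trans (∧-identityʳ c) e)

  ∧-does-⇔ : ∀ b {D : Set} (D? : Dec D) → (b ∧ does D? ≡ true) ⇔ (D × b ≡ true)
  ∧-does-⇔ false D?      = mk⇔ (λ ()) (λ ())
  ∧-does-⇔ true  (yes d) = mk⇔ (λ _ → d , refl) (λ _ → refl)
  ∧-does-⇔ true  (no ¬d) = mk⇔ (λ ()) (λ (d , _) → contradiction d ¬d)

  cross-⇔ : ∀ {k} (x y a : Fin k) b s → (b ∧ does (a ≟ (if s then x else y)) ≡ true) ⇔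
            ((a ≡ x × b ≡ true × s ≡ true) ⊎ (a ≡ y × b ≡ true × s ≡ false))
  cross-⇔ x y a b true  = ⇔.trans (∧-does-⇔ b (a ≟ x))
    (mk⇔ (λ (a≡x , b≡true) → inj₁ (a≡x , b≡true , refl))
         λ { (inj₁ (a≡x , b≡true , _)) → a≡x , b≡true ; (inj₂ (_ , _ , ())) })
  cross-⇔ x y a b false = ⇔.trans (∧-does-⇔ b (a ≟ y))
    (mk⇔ (λ (a≡y , b≡true) → inj₂ (a≡y , b≡true , refl))
         λ { (inj₁ (_ , _ , ())) ; (inj₂ (a≡y , b≡true , _)) → a≡y , b≡true })

  DHGO-gap : ∀ {G₁ G₂ H} → PotentialGap (adj G₁) → PotentialGap (adj G₂) → DHGO G₁ G₂ H → PotentialGap (adj H)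
  DHGO-gap {G₁} {G₂@record { adj = A₂ ; sym = A₂-sym ; irrefl = A₂-irrefl }} {H} gap₁ gap₂
           (m , refl , x , y , z , side , xy∈E , U₁ , U₂ , φ , H⇔) =
    PotentialGap-reindex π H≅composite
      (composition-gap U₁ U₂ gap₁ (PotentialGap-reindex σ (λ _ _ → refl) gap₂))
    where
    -- Relabel G₂ so that z becomes zero and suc j becomes punchIn z j, as in compAdj.
    σ : Fin (suc m) ↔ Fin (suc m)
    σ = Perm.insert zero z Perm.id
    A₂′ : Adjacency (suc m)
    A₂′ i j = A₂ (Inverse.to σ i) (Inverse.to σ j)
    x≢y : x ≢ y
    x≢y refl = contradiction (trans (sym (irrefl G₁ x)) xy∈E) λ ()
    open Composition (adj G₁) A₂′ x y side x≢y xy∈E (trans (Graph.sym G₁ y x) xy∈E)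
                     (A₂-irrefl z) (λ j → A₂-sym _ z)
    composite-⇔ : ∀ p q → (composite p q ≡ true) ⇔ compAdj G₁ m G₂ refl x y z side p q
    composite-⇔ (inj₁ a) (inj₁ b) = ∧-not-does-⇔ (adj G₁ a b) (edge? x y a b)
    composite-⇔ (inj₁ a) (inj₂ j) = cross-⇔ x y a (adjZ j) (side j)
    composite-⇔ (inj₂ j) (inj₁ a) = cross-⇔ x y a (adjZ j) (side j)
    composite-⇔ (inj₂ j) (inj₂ k) = ⇔.refl
    π : Fin (n H) ↔ Fin (n G₁ + m)
    π = ↔-trans φ (↔-sym +↔⊎)
    H≅composite : ∀ u v → adj H u v ≡ Aᶜ (Inverse.to π u) (Inverse.to π v)
    H≅composite u v = trans (Bool-ext (⇔.trans (H⇔ u v) (⇔.sym (composite-⇔ p q)))) (sym (Aᶜ-join p q))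
      where
      p = Inverse.to φ u
      q = Inverse.to φ v

  FourOre-gap : ∀ {F} → FourOre F → PotentialGap (adj F)
  FourOre-gap {F} (k4 (φ , φ-hom)) = PotentialGap-reindex (↔-sym φ) F≅K4 K4-gap
    where
    F≅K4 : ∀ u v → adj F u v ≡ adj K4 (Inverse.from φ u) (Inverse.from φ v)
    F≅K4 u v = trans (sym (cong₂ (adj F) (Inverse.strictlyInverseˡ φ u) (Inverse.strictlyInverseˡ φ v))) (φ-hom _ _)
  FourOre-gap (comp {G₁} {G₂} {H} ore₁ ore₂ dhgo) = DHGO-gap {G₁} {G₂} {H} (FourOre-gap ore₁) (FourOre-gap ore₂) dhgo

  -- From the list-based edge count to ρ₃

  length-filterᵇ-++ : ∀ {X : Set} (p : X → Bool) xs ys →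
                      length (filterᵇ p (xs ++ ys)) ≡ length (filterᵇ p xs) + length (filterᵇ p ys)
  length-filterᵇ-++ p []       ys = refl
  length-filterᵇ-++ p (x ∷ xs) ys with p x
  ... | true  = cong suc (length-filterᵇ-++ p xs ys)
  ... | false = length-filterᵇ-++ p xs ys

  length-filterᵇ-tabulate : ∀ {X : Set} {k} (p : X → Bool) (g : Fin k → X) →
                            length (filterᵇ p (tabulate g)) ≡ ∑[ i < k ] χ (p (g i))
  length-filterᵇ-tabulate {k = zero}  p g = refl
  length-filterᵇ-tabulate {k = suc k} p g with p (g zero)
  ... | true  = cong suc (length-filterᵇ-tabulate p (g ∘ suc))
  ... | false = length-filterᵇ-tabulate p (g ∘ suc)

  length-filterᵇ-concat : ∀ {X : Set} {k} (p : X → Bool) (G : Fin k → List X) →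
                          length (filterᵇ p (concat (tabulate G))) ≡ ∑[ i < k ] length (filterᵇ p (G i))
  length-filterᵇ-concat {k = zero}  p G = refl
  length-filterᵇ-concat {k = suc k} p G =
    trans (length-filterᵇ-++ p (G zero) _) (cong₂ _+_ refl (length-filterᵇ-concat p (G ∘ suc)))

  length-filterᵇ-map-filterᵇ : ∀ {X Y : Set} (p : Y → Bool) (h : X → Y) (q : X → Bool) xs →
                               length (filterᵇ p (map h (filterᵇ q xs))) ≡ length (filterᵇ (λ a → q a ∧ p (h a)) xs)
  length-filterᵇ-map-filterᵇ p h q []       = refl
  length-filterᵇ-map-filterᵇ p h q (x ∷ xs) with q x
  ... | false = length-filterᵇ-map-filterᵇ p h q xs
  ... | true with p (h x)
  ...   | true  = cong suc (length-filterᵇ-map-filterᵇ p h q xs)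
  ...   | false = length-filterᵇ-map-filterᵇ p h q xs

  sum-ordered-pairs : ∀ {k} (Q : Fin k → Fin k → Bool) → (∀ i j → Q i j ≡ Q j i) → (∀ i → Q i i ≡ false) →
                      ∑[ i < k ] ∑[ j < k ] χ (Q i j) ≡ 2 * ∑[ i < k ] ∑[ j < k ] χ ((toℕ i <ᵇ toℕ j) ∧ Q i j)
  sum-ordered-pairs {k} Q Q-sym Q-irr = begin
    ∑[ i < k ] ∑[ j < k ] χ (Q i j)
      ≡⟨ sum-cong-≗ (λ i → trans (sum-cong-≗ (split i)) (∑-distrib-+ (λ j → χ ((toℕ i <ᵇ toℕ j) ∧ Q i j))
                                                                    (λ j → χ ((toℕ j <ᵇ toℕ i) ∧ Q i j)))) ⟩
    ∑[ i < k ] (∑[ j < k ] χ ((toℕ i <ᵇ toℕ j) ∧ Q i j) + ∑[ j < k ] χ ((toℕ j <ᵇ toℕ i) ∧ Q i j))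
      ≡⟨ ∑-distrib-+ (λ i → ∑[ j < k ] χ ((toℕ i <ᵇ toℕ j) ∧ Q i j))
                     (λ i → ∑[ j < k ] χ ((toℕ j <ᵇ toℕ i) ∧ Q i j)) ⟩
    below + ∑[ i < k ] ∑[ j < k ] χ ((toℕ j <ᵇ toℕ i) ∧ Q i j)
      ≡⟨ cong₂ _+_ refl (trans (∑-comm (λ i j → χ ((toℕ j <ᵇ toℕ i) ∧ Q i j)))
                               (sum-cong-≗ λ j → sum-cong-≗ λ i →
                                  cong (λ b → χ ((toℕ j <ᵇ toℕ i) ∧ b)) (Q-sym i j))) ⟩
    below + below
      ≡⟨ cong₂ _+_ refl (+-identityʳ below) ⟨
    2 * below ∎
    where
    open ≡-Reasoning
    below = ∑[ i < k ] ∑[ j < k ] χ ((toℕ i <ᵇ toℕ j) ∧ Q i j)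
    split : ∀ i j → χ (Q i j) ≡ χ ((toℕ i <ᵇ toℕ j) ∧ Q i j) + χ ((toℕ j <ᵇ toℕ i) ∧ Q i j)
    split i j with toℕ i <ᵇ toℕ j | <ᵇ-reflects-< (toℕ i) (toℕ j)
                 | toℕ j <ᵇ toℕ i | <ᵇ-reflects-< (toℕ j) (toℕ i)
    ... | true  | ofʸ i<j | true  | ofʸ j<i = contradiction j<i (<-asym i<j)
    ... | true  | _       | false | _       = sym (+-identityʳ _)
    ... | false | _       | true  | _       = refl
    ... | false | ofⁿ i≮j | false | ofⁿ j≮i =
      cong χ (trans (cong (Q i) (sym (toℕ-injective (≤-antisym (≮⇒≥ j≮i) (≮⇒≥ i≮j))))) (Q-irr i))

  eInd-sum : (F : Graph) (A : Subset (n F)) →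
             eInd F A ≡ ∑[ i < n F ] ∑[ j < n F ] χ ((toℕ i <ᵇ toℕ j) ∧ (lookup A i ∧ lookup A j ∧ adj F i j))
  eInd-sum F A = begin
    eInd F A
      ≡⟨ cong (length ∘ filterᵇ P ∘ concat) (map-tabulate id row) ⟩
    length (filterᵇ P (concat (tabulate row)))
      ≡⟨ length-filterᵇ-concat P row ⟩
    ∑[ i < n F ] length (filterᵇ P (row i))
      ≡⟨ sum-cong-≗ (λ i → trans (length-filterᵇ-map-filterᵇ P (i ,_) (λ j → toℕ i <ᵇ toℕ j) (allFin (n F)))
                                 (length-filterᵇ-tabulate (λ j → (toℕ i <ᵇ toℕ j) ∧ P (i , j)) id)) ⟩
    ∑[ i < n F ] ∑[ j < n F ] χ ((toℕ i <ᵇ toℕ j) ∧ (lookup A i ∧ lookup A j ∧ adj F i j)) ∎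
    where
    open ≡-Reasoning
    P : Fin (n F) × Fin (n F) → Bool
    P (i , j) = lookup A i ∧ lookup A j ∧ adj F i j
    row : Fin (n F) → List (Fin (n F) × Fin (n F))
    row i = map (i ,_) (filterᵇ (λ j → toℕ i <ᵇ toℕ j) (allFin (n F)))

  arcs-lookup : (F : Graph) (A : Subset (n F)) → arcs (adj F) (lookup A) ≡ 2 * eInd F A
  arcs-lookup F A = trans (sum-ordered-pairs _ Q-sym Q-irr) (cong (2 *_) (sym (eInd-sum F A)))
    where
    Q-sym : ∀ i j → lookup A i ∧ lookup A j ∧ adj F i j ≡ lookup A j ∧ lookup A i ∧ adj F j i
    Q-sym i j = trans (cong (λ c → lookup A i ∧ lookup A j ∧ c) (Graph.sym F i j))
                      (x∙yz≈y∙xz (lookup A i) (lookup A j) _)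
    Q-irr : ∀ i → lookup A i ∧ lookup A i ∧ adj F i i ≡ false
    Q-irr i = trans (cong (λ c → lookup A i ∧ lookup A i ∧ c) (irrefl F i)) (∧∧-zeroʳ (lookup A i) (lookup A i))

  count-lookup : ∀ {k} (A : Subset k) → count (lookup A) ≡ ∣ A ∣
  count-lookup []          = refl
  count-lookup (true ∷ A)  = cong suc (count-lookup A)
  count-lookup (false ∷ A) = count-lookup A

  potential≡2ρ3 : (F : Graph) (A : Subset (n F)) → potential (adj F) (lookup A) ≡ + 2 ℤ.* ρ3 F A
  potential≡2ρ3 F A = begin
    potential (adj F) (lookup A)
      ≡⟨ cong₂ (λ c a → 16 * c ⊖ 5 * a) (count-lookup A) (arcs-lookup F A) ⟩
    16 * ∣ A ∣ ⊖ 5 * (2 * e)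
      ≡⟨ ℤₚ.[+m]-[+n]≡m⊖n (16 * ∣ A ∣) (5 * (2 * e)) ⟨
    + (16 * ∣ A ∣) ℤ.- + (5 * (2 * e))
      ≡⟨ cong₂ ℤ._-_ (trans (cong (λ k → + k) (*-assoc 2 8 ∣ A ∣)) (ℤₚ.pos-* 2 (8 * ∣ A ∣)))
                     (trans (cong (λ k → + k) (trans (sym (*-assoc 5 2 e)) (*-assoc 2 5 e))) (ℤₚ.pos-* 2 (5 * e))) ⟩
    + 2 ℤ.* + (8 * ∣ A ∣) ℤ.- + 2 ℤ.* + (5 * e)
      ≡⟨ factor (+ (8 * ∣ A ∣)) (+ (5 * e)) ⟩
    + 2 ℤ.* ρ3 F A ∎
    where
    open ≡-Reasoning
    e = eInd F A
    factor : ∀ p q → + 2 ℤ.* p ℤ.- + 2 ℤ.* q ≡ + 2 ℤ.* (p ℤ.- q)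
    factor = ℤ-Solver.solve-∀

open FourOrePotential using (PotentialGap; FourOre-gap; potential; full; potential-cong; potential≡2ρ3)
open import Data.Fin.Subset using (Nonempty; _∉_)
open import Data.Product using (∃; _×_)
open import Data.Integer using (_≤_; _+_; +_)
open import Data.Bool.Base using (true)
open import Data.Bool.Properties using (¬-not)
open import Data.Integer using (_*_)
import Data.Integer.Properties as ℤₚ
import Data.Integer.Tactic.RingSolver as ℤ-Solver
open import Data.Product using (_,_)
open import Data.Vec.Base using (lookup)
open import Data.Vec.Properties using (lookup-replicate; []=⇒lookup; lookup⇒[]=)
open import Function.Base using (_∘_)
open import Relation.Binary.PropositionalEquality using (_≡_; sym; trans; cong)

lemma2p5 : (F : Graph) → FourOre F → (A : Data.Fin.Subset.Subset (n F)) →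
           Nonempty A → ∃ (λ v → v ∉ A) → ρ3G F + + 6 ≤ ρ3 F A
lemma2p5 F ore A (i , i∈A) (j , j∉A) = ℤₚ.*-cancelˡ-≤-pos (ρ3G F + + 6) (ρ3 F A) (+ 2) (begin
  + 2 * (ρ3G F + + 6)             ≡⟨ distrib (ρ3G F) ⟩
  + 2 * ρ3G F + + 12              ≡⟨ cong (_+ + 12) full≡2ρ3G ⟨
  potential (adj F) full + + 12   ≤⟨ PotentialGap.gap (FourOre-gap ore) (lookup A) (i , []=⇒lookup i∈A)
                                                      (j , ¬-not (j∉A ∘ lookup⇒[]= j A)) ⟩
  potential (adj F) (lookup A)    ≡⟨ potential≡2ρ3 F A ⟩
  + 2 * ρ3 F A                    ∎)
  where
  open ℤₚ.≤-Reasoning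
  distrib : ∀ r → + 2 * (r + + 6) ≡ + 2 * r + + 12
  distrib = ℤ-Solver.solve-∀
  full≡2ρ3G : potential (adj F) full ≡ + 2 * ρ3G F
  full≡2ρ3G = trans (potential-cong (adj F) (λ k → sym (lookup-replicate k true))) (potential≡2ρ3 F Data.Fin.Subset.⊤)
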